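{- Let $p<q$ be positive integers with $\gcd(p,q)=1$. Write $\mathbf f(\tfrac pq)=(f_0,\ldots,f_{4(p+q)-6})$ and $\mathbf f(\tfrac qp)=(f'_0,\ldots,f'_{4(p+q)-6})$. Then for all $0\le i\le 4(p+q)-6$, except possibly $i=2(p+q)-3$, we have $f_i=-$ if and only if $f'_i=+$.
   Context: Lattice. Use the lattice of all unit segments between consecutive integer points on the lines $y=c$, $x=c$, $y=-x+c$ ($c\in\mathbb Z$). Sign sequence $\mathbf f(\tfrac ab)$. For coprime positive integers $a,b$, let $\gamma$ be the segment from $(0,0)$ to $(b,a)$, oriented away from the origin. It crosses lattice segments $\sigma_1,\ldots,\sigma_{N}$, $N=2(a+b)-3$, in order at points $s_i$. Then $\mathbf f(\tfrac ab)=(f_0,\ldots,f_{2N})$ is defined as follows. - For $1\le i\le N$: $f_{2i-1}=-$ if $s_i$ is closer to the endpoint of $\sigma_i$ lying to the right of $\gamma$, and $+$ if closer to the left one. Only the middle crossing $i=a+b-1$ is at a midpoint; there the sign may be chosen freely. - For $1\le i\le N-1$: $f_{2i}=-$ if the common endpoint of $\sigma_i,\sigma_{i+1}$ lies to the right of $\gamma$, and $+$ otherwise. - The end conventions are: if $a\le b$, then $f_0=-$ and $f_{2N}=+$; if $a>b$, then $f_0=+$ and $f_{2N}=-$. -}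

module Defs where

open import Data.Nat.Base using (ℕ; zero; suc; _+_; _*_; _∸_; _/_; _<ᵇ_; _≡ᵇ_; _≤ᵇ_; ∣_-_∣)
open import Data.Bool.Base using (Bool; true; false; if_then_else_; _∧_)
open import Data.List.Base using (List; []; _∷_; _++_; [_]; map; upTo)
open import Data.Maybe.Base using (Maybe; just; nothing)
open import Data.Product.Base using (_×_; _,_; proj₁; proj₂)
open import Data.Sign.Base using (Sign) renaming (- to minus; + to plus)

Point : Set
Point = ℕ × ℕ

-- Floor division, with a harmless convention for divisor 0.
floorDiv : ℕ → ℕ → ℕ
floorDiv n zero    = 0
floorDiv n (suc d) = n / suc d

-- The three families of lattice lines crossed by γ (interior crossings):
--   vert k : x = k        (1 ≤ k ≤ b-1), crossed at parameter t = k/b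
--   horiz k: y = k        (1 ≤ k ≤ a-1), crossed at parameter t = k/a
--   diag k : x + y = k    (1 ≤ k ≤ a+b-1), crossed at parameter t = k/(a+b)
-- γ(t) = (t b, t a), t ∈ [0,1].
data Kind : Set where
  vert horiz diag : Kind

record Crossing : Set where
  constructor mkCrossing
  field
    kind : Kind
    idx  : ℕ

open Crossing public

module Geometry (a b : ℕ) where

  den : Kind → ℕ
  den vert  = b
  den horiz = a
  den diag  = a + b

  -- γ(t) crosses σ before γ(t') crosses σ'  (t < t', cross-multiplied)
  before : Crossing → Crossing → Bool
  before c c' = (idx c * den (kind c')) <ᵇ (idx c' * den (kind c))

  insert : Crossing → List Crossing → List Crossing
  insert c []       = c ∷ []
  insert c (x ∷ xs) = if before c x then c ∷ x ∷ xs else x ∷ insert c xs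

  sort : List Crossing → List Crossing
  sort []       = []
  sort (x ∷ xs) = insert x (sort xs)

  range1 : ℕ → List ℕ
  range1 n = map suc (upTo (n ∸ 1))

  crossings : List Crossing
  crossings = sort (map (mkCrossing vert) (range1 b)
                 ++ map (mkCrossing horiz) (range1 a)
                 ++ map (mkCrossing diag) (range1 (a + b)))

  -- endpoints of the lattice segment σ containing the crossing point
  endpoints : Crossing → Point × Point
  endpoints (mkCrossing vert k)  =
    let m = floorDiv (k * a) b in (k , m) , (k , suc m)
  endpoints (mkCrossing horiz k) =
    let m = floorDiv (k * b) a in (m , k) , (suc m , k)
  endpoints (mkCrossing diag k)  =
    let m = floorDiv (k * b) (a + b) in (m , k ∸ m) , (suc m , k ∸ suc m)

  -- A lattice point P lies to the left of γ (oriented from (0,0) to (b,a))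
  -- iff the cross product (b,a) × P = b·P_y − a·P_x is positive.
  isLeft : Point → Bool
  isLeft (x , y) = (a * x) <ᵇ (b * y)

  sideSign : Point → Sign
  sideSign P = if isLeft P then plus else minus

  -- squared distance from the crossing point s to a lattice point P,
  -- scaled by d² where d = den (kind c):  d·s = (k b, k a)
  dist2 : Crossing → Point → ℕ
  dist2 c (x , y) =
    let d = den (kind c) ; k = idx c
        dx = ∣ k * b - d * x ∣ ; dy = ∣ k * a - d * y ∣
    in dx * dx + dy * dy

  -- f_{2i-1}: sign of the endpoint of σ_i closer to s_i;
  -- at a midpoint the freely chosen sign `mid` is used
  crossSign : Sign → Crossing → Sign
  crossSign mid c =
    let P = proj₁ (endpoints c) ; Q = proj₂ (endpoints c) in
    if dist2 c P <ᵇ dist2 c Q then sideSign P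
    else if dist2 c Q <ᵇ dist2 c P then sideSign Q
    else mid

  pointEq : Point → Point → Bool
  pointEq (x , y) (x' , y') = (x ≡ᵇ x') ∧ (y ≡ᵇ y')

  commonEndpoint : Crossing → Crossing → Point
  commonEndpoint c c' =
    let P = proj₁ (endpoints c) ; Q = proj₂ (endpoints c)
        P' = proj₁ (endpoints c') ; Q' = proj₂ (endpoints c')
    in if pointEq P P' then P else if pointEq P Q' then P else Q

  body : Sign → List Crossing → List Sign
  body mid []             = []
  body mid (c ∷ [])       = crossSign mid c ∷ []
  body mid (c ∷ c' ∷ cs)  =
    crossSign mid c ∷ sideSign (commonEndpoint c c') ∷ body mid (c' ∷ cs)

  startSign endSign : Sign
  startSign = if a ≤ᵇ b then minus else plus
  endSign   = if a ≤ᵇ b then plus  else minus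

  seq : Sign → List Sign
  seq mid = startSign ∷ body mid crossings ++ [ endSign ]

-- f(a/b) = (f_0, …, f_{2N}), where `mid` is the free choice of sign at the
-- middle crossing (the one crossing at a midpoint).
fSeq : ℕ → ℕ → Sign → List Sign
fSeq a b mid = Geometry.seq a b mid

_!?_ : {A : Set} → List A → ℕ → Maybe A
[]       !? _       = nothing
(x ∷ xs) !? zero    = just x
(x ∷ xs) !? suc n   = xs !? n

f : ℕ → ℕ → Sign → ℕ → Maybe Sign
f a b mid i = fSeq a b mid !? i

{-# OPTIONS --safe #-}
-- Reflection in the line y = x maps γ for p/q onto γ for q/p and the lattice onto itself,
-- exchanging vertical and horizontal segments and fixing the diagonal family. It preserves
-- the crossing parameters, which coprimality makes pairwise distinct, so the crossed segments
-- for q/p are the reflections of those for p/q, in the same order. It also preserves distances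
-- and, since coprimality keeps every lattice point off γ, turns each point left of γ into one
-- right of it; hence every crossing sign and every common-endpoint sign is negated, and so are
-- the end conventions. The common endpoint needs care only after a diagonal segment, whose two
-- endpoints the reflection lists in the opposite order: there one checks that the next crossed
-- segment contains exactly one of them. Finally, the free sign sits at the crossing with
-- parameter 1/2, and counting the crossings before it (⌊(b-1)/2⌋ + ⌊(a-1)/2⌋ + ⌊(a+b-1)/2⌋,
-- which is a + b - 2 as a and b are not both even) puts it at index 2(p+q)-3.
module Submission where

open import Defs
open import Data.Bool.Base using (Bool; true; false; if_then_else_; T; _∨_)
open import Data.Bool.Properties using (if-∨; if-float; ∧-comm; ∨-comm)
open import Data.Empty using (⊥-elim)
open import Data.List.Base using (List; []; _∷_; _++_; [_]; map; upTo)
open import Data.List.Properties using (upTo-∷ʳ; map-++)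
open import Data.List.Membership.Propositional using (_∈_; _∉_)
open import Data.List.Membership.Propositional.Properties
  using (∈-map⁺; ∈-map⁻; ∈-++⁺ˡ; ∈-++⁺ʳ; ∈-++⁻; ∈-upTo⁺; ∈-upTo⁻)
open import Data.List.Relation.Binary.Permutation.Propositional as ↭
  using (_↭_; ↭-refl; ↭-prep; ↭-swap; ↭-trans; ↭-sym)
open import Data.List.Relation.Binary.Permutation.Propositional.Properties
  using (∈-resp-↭; All-resp-↭)
open import Data.List.Relation.Unary.All as All using (All; []; _∷_)
open import Data.List.Relation.Unary.All.Properties using (map⁺)
open import Data.List.Relation.Unary.Any using (here; there)
open import Data.List.Relation.Unary.Linked using (Linked; []; [-]; _∷_)
open import Data.List.Relation.Unary.Unique.Propositional using (Unique; []; _∷_)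
import Data.List.Relation.Unary.Unique.Propositional.Properties as Unique
open import Data.Maybe.Base as Maybe using (Maybe; just)
open import Data.Nat.Base
open import Data.Nat.Coprimality using (Coprime; coprime-divisor; coprime-+; gcd≡1⇒coprime)
  renaming (sym to coprime-sym)
open import Data.Nat.DivMod using (m/n*n≤m; m≡m%n+[m/n]*n; m%n<n; m<n*o⇒m/o<n; m*n/n≡m; /-monoˡ-≤)
open import Data.Nat.Divisibility using (divides; ∣⇒≤)
open import Data.Nat.GCD using (gcd)
open import Data.Nat.Properties
open import Data.Nat.Tactic.RingSolver using (solve-∀)
open import Data.Product.Base using (_×_; _,_; proj₁; proj₂; ∃; swap)
open import Data.Sign.Base using (Sign; opposite) renaming (- to minus; + to plus)
open import Data.Sign.Properties using (opposite-involutive)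
open import Data.Sum.Base using (_⊎_; inj₁; inj₂)
open import Data.Unit.Base using (tt)
open import Function.Base using (_∘′_)
open import Function.Bundles using (_⇔_; mk⇔)
open import Relation.Binary.Definitions using (tri<; tri≈; tri>)
open import Relation.Binary.PropositionalEquality hiding ([_])
open import Relation.Nullary using (¬_; contradiction)

-- Arithmetic

<ᵇ≡true⇒< : ∀ {m n} → (m <ᵇ n) ≡ true → m < n
<ᵇ≡true⇒< {m} {n} m<ᵇn = <ᵇ⇒< m n (subst T (sym m<ᵇn) tt)

<⇒<ᵇ≡true : ∀ {m n} → m < n → (m <ᵇ n) ≡ true
<⇒<ᵇ≡true {m} {n} m<n with m <ᵇ n | <⇒<ᵇ m<n
... | true | _ = refl

<ᵇ≡false⇒≥ : ∀ {m n} → (m <ᵇ n) ≡ false → n ≤ m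
<ᵇ≡false⇒≥ m≮ᵇn = ≮⇒≥ λ m<n → subst T m≮ᵇn (<⇒<ᵇ m<n)

≥⇒<ᵇ≡false : ∀ {m n} → n ≤ m → (m <ᵇ n) ≡ false
≥⇒<ᵇ≡false {m} {n} n≤m with m <ᵇ n in m<ᵇn
... | false = refl
... | true  = ⊥-elim (≤⇒≯ n≤m (<ᵇ≡true⇒< m<ᵇn))

<ᵇ-cong : ∀ {m n m′ n′} → (m < n → m′ < n′) → (m′ < n′ → m < n) → (m <ᵇ n) ≡ (m′ <ᵇ n′)
<ᵇ-cong {m′ = m′} {n′} to from with m′ <ᵇ n′ in m′<ᵇn′
... | true  = <⇒<ᵇ≡true (from (<ᵇ≡true⇒< m′<ᵇn′))
... | false = ≥⇒<ᵇ≡false (≮⇒≥ λ m<n → <⇒≱ (to m<n) (<ᵇ≡false⇒≥ m′<ᵇn′))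

m<[1+m/n]*n : ∀ m n .{{_ : NonZero n}} → m < suc (m / n) * n
m<[1+m/n]*n m n = begin-strict
  m                    ≡⟨ m≡m%n+[m/n]*n m n ⟩
  m % n + m / n * n    <⟨ +-monoˡ-< (m / n * n) (m%n<n m n) ⟩
  n + m / n * n        ∎
  where open ≤-Reasoning

/-unique : ∀ m n q .{{_ : NonZero n}} → q * n ≤ m → m < suc q * n → m / n ≡ q
/-unique m n q lower upper = ≤-antisym (≤-pred (m<n*o⇒m/o<n upper))
  (subst (_≤ m / n) (m*n/n≡m q n) (/-monoˡ-≤ n lower))

coprime⇒*≢* : ∀ {d e} → Coprime d e → ∀ {k} j → 0 < k → k < d → k * e ≢ j * d
coprime⇒*≢* {e = e} coprime {k} j 0<k k<d ke≡jd =
  <⇒≱ k<d (∣⇒≤ {{>-nonZero 0<k}} (coprime-divisor coprime (divides j (trans (*-comm e k) ke≡jd))))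

coprime⇒2k≡d : ∀ {d e} → Coprime d e → ∀ {k} j → 0 < k → k < d → 2 * k * e ≡ j * d → 2 * k ≡ d
coprime⇒2k≡d {d} {e} coprime {k} j 0<k k<d 2ke≡jd
  with coprime-divisor coprime (divides j (trans (*-comm e (2 * k)) 2ke≡jd))
... | divides 0 2k≡0 = contradiction 2k≡0 (>⇒≢ (*-monoʳ-< 2 0<k))
... | divides 1 2k≡d = trans 2k≡d (*-identityˡ d)
... | divides (suc (suc q)) 2k≡[2+q]d = contradiction (*-monoʳ-< 2 k<d) (≤⇒≯ (begin
  2 * d              ≤⟨ m≤m+n (2 * d) (q * d) ⟩
  2 * d + q * d      ≡⟨ *-distribʳ-+ d 2 q ⟨
  suc (suc q) * d    ≡⟨ 2k≡[2+q]d ⟨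
  2 * k              ∎))
  where open ≤-Reasoning

equidistant⇒midpoint : ∀ x y d → y ≤ x → x < y + d → ∣ x - y ∣ ≡ ∣ x - (y + d) ∣ → 2 * x ≡ 2 * y + d
equidistant⇒midpoint x y d y≤x x<y+d equidistant = begin
  2 * x              ≡⟨ cong (2 *_) y+u≡x ⟨
  2 * (y + u)        ≡⟨ *-distribˡ-+ 2 y u ⟩
  2 * y + 2 * u      ≡⟨ cong (λ v → 2 * y + (u + v)) (+-identityʳ u) ⟩
  2 * y + (u + u)    ≡⟨ cong (2 * y +_) u+u≡d ⟩
  2 * y + d          ∎
  where
  open ≡-Reasoning
  u : ℕ
  u = x ∸ y
  y+u≡x : y + u ≡ x
  y+u≡x = m+[n∸m]≡n y≤x
  y+d∸x≡u : y + d ∸ x ≡ u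
  y+d∸x≡u = trans (sym (m≤n⇒∣m-n∣≡n∸m (<⇒≤ x<y+d))) (trans (sym equidistant) (m≤n⇒∣n-m∣≡n∸m y≤x))
  u+u≡d : u + u ≡ d
  u+u≡d = +-cancelˡ-≡ y (u + u) d (begin
    y + (u + u)  ≡⟨ +-assoc y u u ⟨
    y + u + u    ≡⟨ cong (_+ u) y+u≡x ⟩
    x + u        ≡⟨ cong (x +_) y+d∸x≡u ⟨
    x + (y + d ∸ x) ≡⟨ m+[n∸m]≡n (<⇒≤ x<y+d) ⟩
    y + d        ∎)

equidistant⇒2k≡d : ∀ {d e} .{{_ : NonZero d}} → Coprime d e → ∀ {k} → 0 < k → k < d →
  ∣ k * e - d * (k * e / d) ∣ ≡ ∣ k * e - d * suc (k * e / d) ∣ → 2 * k ≡ d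
equidistant⇒2k≡d {d} {e} coprime {k} 0<k k<d equidistant =
  coprime⇒2k≡d coprime (suc (2 * q)) 0<k k<d (begin
    2 * k * e          ≡⟨ *-assoc 2 k e ⟩
    2 * (k * e)        ≡⟨ equidistant⇒midpoint (k * e) (d * q) d lower upper equidistant′ ⟩
    2 * (d * q) + d    ≡⟨ rearrange d q ⟩
    suc (2 * q) * d    ∎)
  where
  open ≡-Reasoning
  q : ℕ
  q = k * e / d
  lower : d * q ≤ k * e
  lower = subst (_≤ k * e) (*-comm q d) (m/n*n≤m (k * e) d)
  d*suc : d * suc q ≡ d * q + d
  d*suc = trans (*-suc d q) (+-comm d (d * q))
  upper : k * e < d * q + d
  upper = subst (k * e <_) (trans (*-comm (suc q) d) d*suc) (m<[1+m/n]*n (k * e) d)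
  equidistant′ : ∣ k * e - d * q ∣ ≡ ∣ k * e - (d * q + d) ∣
  equidistant′ = trans equidistant (cong (∣ k * e -_∣) d*suc)
  rearrange : ∀ d q → 2 * (d * q) + d ≡ suc (2 * q) * d
  rearrange = solve-∀

*-self-injective : ∀ {u v} → u * u ≡ v * v → u ≡ v
*-self-injective {u} {v} u²≡v² with <-cmp u v
... | tri< u<v _ _ = contradiction u²≡v² (<⇒≢ (*-mono-< u<v u<v))
... | tri≈ _ u≡v _ = u≡v
... | tri> _ _ v<u = contradiction u²≡v² (≢-sym (<⇒≢ (*-mono-< v<u v<u)))

+-self-injective : ∀ {u v} → u + u ≡ v + v → u ≡ v
+-self-injective {u} {v} 2u≡2v with <-cmp u v
... | tri< u<v _ _ = contradiction 2u≡2v (<⇒≢ (+-mono-< u<v u<v))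
... | tri≈ _ u≡v _ = u≡v
... | tri> _ _ v<u = contradiction 2u≡2v (≢-sym (<⇒≢ (+-mono-< v<u v<u)))

∣-∣-shift : ∀ p q p′ q′ → p + q′ ≡ p′ + q → ∣ p - q ∣ ≡ ∣ p′ - q′ ∣
∣-∣-shift p q p′ q′ p+q′≡p′+q = begin
  ∣ p - q ∣                ≡⟨ ∣m+n-m+o∣≡∣n-o∣ q′ p q ⟨
  ∣ q′ + p - q′ + q ∣      ≡⟨ cong₂ ∣_-_∣ (trans (+-comm q′ p) p+q′≡p′+q) (+-comm q′ q) ⟩
  ∣ p′ + q - q + q′ ∣      ≡⟨ cong (∣_- q + q′ ∣) (+-comm p′ q) ⟩
  ∣ q + p′ - q + q′ ∣      ≡⟨ ∣m+n-m+o∣≡∣n-o∣ q p′ q′ ⟩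
  ∣ p′ - q′ ∣              ∎
  where open ≡-Reasoning

*-rightComm : ∀ x y z → x * y * z ≡ x * z * y
*-rightComm x y z = trans (*-assoc x y z) (trans (cong (x *_) (*-comm y z)) (sym (*-assoc x z y)))

cross-<-trans : ∀ k₁ k₂ k₃ {d₁ d₂ d₃} → 0 < d₁ → 0 < d₃ →
  k₁ * d₂ < k₂ * d₁ → k₂ * d₃ < k₃ * d₂ → k₁ * d₃ < k₃ * d₁
cross-<-trans k₁ k₂ k₃ {d₁} {d₂} {d₃} 0<d₁ 0<d₃ k₁d₂<k₂d₁ k₂d₃<k₃d₂ =
  *-cancelʳ-< d₂ (k₁ * d₃) (k₃ * d₁) (begin-strict
    k₁ * d₃ * d₂   ≡⟨ *-rightComm k₁ d₃ d₂ ⟩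
    k₁ * d₂ * d₃   <⟨ *-monoˡ-< d₃ {{>-nonZero 0<d₃}} k₁d₂<k₂d₁ ⟩
    k₂ * d₁ * d₃   ≡⟨ *-rightComm k₂ d₁ d₃ ⟩
    k₂ * d₃ * d₁   <⟨ *-monoˡ-< d₁ {{>-nonZero 0<d₁}} k₂d₃<k₃d₂ ⟩
    k₃ * d₂ * d₁   ≡⟨ *-rightComm k₃ d₂ d₁ ⟩
    k₃ * d₁ * d₂   ∎)
  where open ≤-Reasoning

≡ᵇ-refl : ∀ n → (n ≡ᵇ n) ≡ true
≡ᵇ-refl zero    = refl
≡ᵇ-refl (suc n) = ≡ᵇ-refl n

n≡ᵇ1+n : ∀ n → (n ≡ᵇ suc n) ≡ false
n≡ᵇ1+n zero    = refl
n≡ᵇ1+n (suc n) = n≡ᵇ1+n n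

1+n≡ᵇn : ∀ n → (suc n ≡ᵇ n) ≡ false
1+n≡ᵇn zero    = refl
1+n≡ᵇn (suc n) = 1+n≡ᵇn n

-- Counting

count : ∀ {A : Set} → (A → Bool) → List A → ℕ
count p []       = 0
count p (x ∷ xs) = if p x then suc (count p xs) else count p xs

module _ {A : Set} where

  count-++ : ∀ (p : A → Bool) xs ys → count p (xs ++ ys) ≡ count p xs + count p ys
  count-++ p []       ys = refl
  count-++ p (x ∷ xs) ys with p x
  ... | true  = cong suc (count-++ p xs ys)
  ... | false = count-++ p xs ys

  count-map : ∀ {B : Set} (p : B → Bool) (f : A → B) xs → count p (map f xs) ≡ count (λ x → p (f x)) xs
  count-map p f []       = refl
  count-map p f (x ∷ xs) with p (f x)
  ... | true  = cong suc (count-map p f xs)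
  ... | false = count-map p f xs

  count-cong : ∀ {p q : A → Bool} → (∀ x → p x ≡ q x) → ∀ xs → count p xs ≡ count q xs
  count-cong p≗q []       = refl
  count-cong {q = q} p≗q (x ∷ xs) rewrite p≗q x with q x
  ... | true  = cong suc (count-cong p≗q xs)
  ... | false = count-cong p≗q xs

  count-resp-↭ : ∀ (p : A → Bool) {xs ys} → xs ↭ ys → count p xs ≡ count p ys
  count-resp-↭ p ↭.refl = refl
  count-resp-↭ p (↭.prep x xs↭ys) with p x
  ... | true  = cong suc (count-resp-↭ p xs↭ys)
  ... | false = count-resp-↭ p xs↭ys
  count-resp-↭ p (↭.swap x y xs↭ys) with p x | p y
  ... | true  | true  = cong (suc ∘′ suc) (count-resp-↭ p xs↭ys)
  ... | true  | false = cong suc (count-resp-↭ p xs↭ys)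
  ... | false | true  = cong suc (count-resp-↭ p xs↭ys)
  ... | false | false = count-resp-↭ p xs↭ys
  count-resp-↭ p (↭.trans xs↭ys ys↭zs) = trans (count-resp-↭ p xs↭ys) (count-resp-↭ p ys↭zs)

count-<ᵇ-upTo : ∀ h n → count (_<ᵇ h) (upTo n) ≡ n ⊓ h
count-<ᵇ-upTo h zero    = refl
count-<ᵇ-upTo h (suc n) = begin
  count (_<ᵇ h) (upTo (suc n))                  ≡⟨ cong (count (_<ᵇ h)) (upTo-∷ʳ n) ⟨
  count (_<ᵇ h) (upTo n ++ [ n ])               ≡⟨ count-++ (_<ᵇ h) (upTo n) [ n ] ⟩
  count (_<ᵇ h) (upTo n) + count (_<ᵇ h) [ n ]  ≡⟨ cong (_+ count (_<ᵇ h) [ n ]) (count-<ᵇ-upTo h n) ⟩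
  n ⊓ h + count (_<ᵇ h) [ n ]                   ≡⟨ last-step ⟩
  suc n ⊓ h                                     ∎
  where
  open ≡-Reasoning
  last-step : n ⊓ h + count (_<ᵇ h) [ n ] ≡ suc n ⊓ h
  last-step with n <ᵇ h in n<ᵇh
  ... | true  = trans (cong (_+ 1) (m≤n⇒m⊓n≡m (<⇒≤ n<h))) (trans (+-comm n 1) (sym (m≤n⇒m⊓n≡m n<h)))
    where n<h = <ᵇ≡true⇒< n<ᵇh
  ... | false = trans (+-identityʳ _) (trans (m≥n⇒m⊓n≡n h≤n) (sym (m≥n⇒m⊓n≡n (m≤n⇒m≤1+n h≤n))))
    where h≤n = <ᵇ≡false⇒≥ n<ᵇh

2+2k<ᵇ1+n≡k<ᵇ⌊n/2⌋ : ∀ k n → (suc (suc (2 * k)) <ᵇ suc n) ≡ (k <ᵇ ⌊ n /2⌋)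
2+2k<ᵇ1+n≡k<ᵇ⌊n/2⌋ k       zero          = refl
2+2k<ᵇ1+n≡k<ᵇ⌊n/2⌋ k       (suc zero)    = refl
2+2k<ᵇ1+n≡k<ᵇ⌊n/2⌋ zero    (suc (suc n)) = refl
2+2k<ᵇ1+n≡k<ᵇ⌊n/2⌋ (suc k) (suc (suc n)) =
  trans (cong (_<ᵇ suc n) (*-suc 2 k)) (2+2k<ᵇ1+n≡k<ᵇ⌊n/2⌋ k n)

count-below-half : ∀ n → count (λ k → 2 * k <ᵇ suc n) (map suc (upTo n)) ≡ ⌊ n /2⌋
count-below-half n = begin
  count (λ k → 2 * k <ᵇ suc n) (map suc (upTo n))  ≡⟨ count-map _ suc (upTo n) ⟩
  count (λ k → 2 * suc k <ᵇ suc n) (upTo n)        ≡⟨ count-cong below-half (upTo n) ⟩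
  count (_<ᵇ ⌊ n /2⌋) (upTo n)                     ≡⟨ count-<ᵇ-upTo ⌊ n /2⌋ n ⟩
  n ⊓ ⌊ n /2⌋                                      ≡⟨ m≥n⇒m⊓n≡n (⌊n/2⌋≤n n) ⟩
  ⌊ n /2⌋                                          ∎
  where
  open ≡-Reasoning
  below-half : ∀ k → (2 * suc k <ᵇ suc n) ≡ (k <ᵇ ⌊ n /2⌋)
  below-half k = trans (cong (_<ᵇ suc n) (*-suc 2 k)) (2+2k<ᵇ1+n≡k<ᵇ⌊n/2⌋ k n)

even⊎odd : ∀ n → ∃ λ t → n ≡ t + t ⊎ n ≡ suc (t + t)
even⊎odd zero    = 0 , inj₁ refl
even⊎odd (suc n) with even⊎odd n
... | t , inj₁ n≡2t   = t , inj₂ (cong suc n≡2t)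
... | t , inj₂ n≡2t+1 = suc t , inj₁ (cong suc (trans n≡2t+1 (sym (+-suc t t))))

⌊t+t+n/2⌋≡t+⌊n/2⌋ : ∀ t n → ⌊ t + t + n /2⌋ ≡ t + ⌊ n /2⌋
⌊t+t+n/2⌋≡t+⌊n/2⌋ zero    n = refl
⌊t+t+n/2⌋≡t+⌊n/2⌋ (suc t) n =
  trans (cong (λ m → ⌊ suc m + n /2⌋) (+-suc t t)) (cong suc (⌊t+t+n/2⌋≡t+⌊n/2⌋ t n))

-- Coprimality is used only to exclude that a′ and b′ are both odd.
sum-of-halves : ∀ a′ b′ → Coprime (suc a′) (suc b′) →
  ⌊ b′ /2⌋ + (⌊ a′ /2⌋ + ⌊ a′ + suc b′ /2⌋) ≡ a′ + b′
sum-of-halves a′ b′ coprime with even⊎odd a′ | even⊎odd b′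
... | t , inj₁ refl | _ = begin
  ⌊ b′ /2⌋ + (⌊ t + t /2⌋ + ⌊ t + t + suc b′ /2⌋)
    ≡⟨ cong₂ (λ x y → ⌊ b′ /2⌋ + (x + y)) (sym (n≡⌊n+n/2⌋ t)) (⌊t+t+n/2⌋≡t+⌊n/2⌋ t (suc b′)) ⟩
  ⌊ b′ /2⌋ + (t + (t + ⌈ b′ /2⌉))                  ≡⟨ rearrange t ⌊ b′ /2⌋ ⌈ b′ /2⌉ ⟩
  t + t + (⌊ b′ /2⌋ + ⌈ b′ /2⌉)                    ≡⟨ cong (t + t +_) (⌊n/2⌋+⌈n/2⌉≡n b′) ⟩
  t + t + b′                                       ∎
  where
  open ≡-Reasoning
  rearrange : ∀ t x y → x + (t + (t + y)) ≡ t + t + (x + y)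
  rearrange = solve-∀
... | _ | t , inj₁ refl = begin
  ⌊ t + t /2⌋ + (⌊ a′ /2⌋ + ⌊ a′ + suc (t + t) /2⌋)
    ≡⟨ cong₂ (λ x y → x + (⌊ a′ /2⌋ + y)) (sym (n≡⌊n+n/2⌋ t)) half-last ⟩
  t + (⌊ a′ /2⌋ + (t + ⌈ a′ /2⌉))                   ≡⟨ rearrange t ⌊ a′ /2⌋ ⌈ a′ /2⌉ ⟩
  ⌊ a′ /2⌋ + ⌈ a′ /2⌉ + (t + t)                     ≡⟨ cong (_+ (t + t)) (⌊n/2⌋+⌈n/2⌉≡n a′) ⟩
  a′ + (t + t)                                      ∎
  where
  open ≡-Reasoning
  rearrange : ∀ t x y → t + (x + (t + y)) ≡ x + y + (t + t)
  rearrange = solve-∀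
  swap-sum : ∀ a′ t → a′ + suc (t + t) ≡ t + t + suc a′
  swap-sum = solve-∀
  half-last : ⌊ a′ + suc (t + t) /2⌋ ≡ t + ⌈ a′ /2⌉
  half-last = trans (cong ⌊_/2⌋ (swap-sum a′ t)) (⌊t+t+n/2⌋≡t+⌊n/2⌋ t (suc a′))
... | s , inj₂ refl | t , inj₂ refl = contradiction
  (coprime (divides (suc s) (double s) , divides (suc t) (double t))) λ ()
  where
  double : ∀ n → suc (suc (n + n)) ≡ suc n * 2
  double = solve-∀

-- Insertion sort

!?⇒∈ : ∀ {A : Set} {x : A} xs j → xs !? j ≡ just x → x ∈ xs
!?⇒∈ (y ∷ xs) zero    refl         = here refl
!?⇒∈ (y ∷ xs) (suc j) xs!?j≡just-x = there (!?⇒∈ xs j xs!?j≡just-x)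

module InsertionSort {A : Set} (_≺ᵇ_ : A → A → Bool) where

  _≺_ : A → A → Set
  x ≺ y = (x ≺ᵇ y) ≡ true

  insert : A → List A → List A
  insert x []       = x ∷ []
  insert x (y ∷ ys) = if x ≺ᵇ y then x ∷ y ∷ ys else y ∷ insert x ys

  sort : List A → List A
  sort []       = []
  sort (x ∷ xs) = insert x (sort xs)

  insert↭ : ∀ x xs → insert x xs ↭ x ∷ xs
  insert↭ x []       = ↭-refl
  insert↭ x (y ∷ ys) with x ≺ᵇ y
  ... | true  = ↭-refl
  ... | false = ↭-trans (↭-prep y (insert↭ x ys)) (↭-swap y x ↭-refl)

  sort↭ : ∀ xs → sort xs ↭ xs
  sort↭ []       = ↭-refl
  sort↭ (x ∷ xs) = ↭-trans (insert↭ x (sort xs)) (↭-prep x (sort↭ xs))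

  data Sorted : List A → Set where
    []  : Sorted []
    _∷_ : ∀ {x xs} → All (x ≺_) xs → Sorted xs → Sorted (x ∷ xs)

  module StrictTotalOn
    (V : A → Set)
    (≺-irrefl : ∀ {x} → ¬ x ≺ x)
    (≺-trans : ∀ {x y z} → x ≺ y → y ≺ z → x ≺ z)
    (≺-tri : ∀ {x y} → V x → V y → x ≺ y ⊎ x ≡ y ⊎ y ≺ x)
    where

    ≺-asym : ∀ {x y} → x ≺ y → ¬ y ≺ x
    ≺-asym x≺y y≺x = ≺-irrefl (≺-trans x≺y y≺x)

    ¬≺⇒≺ᵇ≡false : ∀ {x y} → ¬ x ≺ y → (x ≺ᵇ y) ≡ false
    ¬≺⇒≺ᵇ≡false {x} {y} x⊀y with x ≺ᵇ y
    ... | true  = ⊥-elim (x⊀y refl)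
    ... | false = refl

    count-≺-all-above : ∀ {x xs} → All (x ≺_) xs → count (_≺ᵇ x) xs ≡ 0
    count-≺-all-above []                 = refl
    count-≺-all-above (x≺y ∷ x≺ys) rewrite ¬≺⇒≺ᵇ≡false (≺-asym x≺y) = count-≺-all-above x≺ys

    count-≺-sorted : ∀ {x} xs j → Sorted xs → xs !? j ≡ just x → count (_≺ᵇ x) xs ≡ j
    count-≺-sorted (y ∷ ys) zero    (y≺ys ∷ _) refl
      rewrite ¬≺⇒≺ᵇ≡false (≺-irrefl {y}) = count-≺-all-above y≺ys
    count-≺-sorted (y ∷ ys) (suc j) (y≺ys ∷ ys-sorted) ys!?j≡just-x
      rewrite All.lookup y≺ys (!?⇒∈ ys j ys!?j≡just-x) =
        cong suc (count-≺-sorted ys j ys-sorted ys!?j≡just-x)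

    sorted-unique : ∀ {xs ys} → Sorted xs → Sorted ys →
      (∀ {z} → z ∈ xs → z ∈ ys) → (∀ {z} → z ∈ ys → z ∈ xs) → xs ≡ ys
    sorted-unique [] [] _ _ = refl
    sorted-unique [] (_ ∷ _) _ ys⊆xs with ys⊆xs (here refl)
    ... | ()
    sorted-unique (_ ∷ _) [] xs⊆ys _ with xs⊆ys (here refl)
    ... | ()
    sorted-unique {x ∷ xs} {y ∷ ys} (x≺xs ∷ xs-sorted) (y≺ys ∷ ys-sorted) xs⊆ys ys⊆xs =
      cong₂ _∷_ x≡y (sorted-unique xs-sorted ys-sorted tail⊆ tail⊇)
      where
      x≡y : x ≡ y
      x≡y with xs⊆ys (here refl) | ys⊆xs (here refl)
      ... | here x≡y  | _         = x≡y
      ... | there _   | here y≡x  = sym y≡x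
      ... | there x∈ys | there y∈xs = contradiction (All.lookup y≺ys x∈ys) (≺-asym (All.lookup x≺xs y∈xs))
      tail⊆ : ∀ {z} → z ∈ xs → z ∈ ys
      tail⊆ z∈xs with xs⊆ys (there z∈xs)
      ... | there z∈ys = z∈ys
      ... | here refl  = contradiction (subst (_≺ _) x≡y (All.lookup x≺xs z∈xs)) ≺-irrefl
      tail⊇ : ∀ {z} → z ∈ ys → z ∈ xs
      tail⊇ z∈ys with ys⊆xs (there z∈ys)
      ... | there z∈xs = z∈xs
      ... | here refl  = contradiction (subst (_≺ _) (sym x≡y) (All.lookup y≺ys z∈ys)) ≺-irrefl

    insert-sorted : ∀ {x xs} → V x → All V xs → x ∉ xs → Sorted xs → Sorted (insert x xs)
    insert-sorted {xs = []} _ _ _ [] = [] ∷ []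
    insert-sorted {x} {y ∷ ys} vx (vy ∷ vys) x∉y∷ys (y≺ys ∷ ys-sorted) with x ≺ᵇ y in x≺ᵇy
    ... | true  = (x≺ᵇy ∷ All.map (≺-trans x≺ᵇy) y≺ys) ∷ y≺ys ∷ ys-sorted
    ... | false = All-resp-↭ (↭-sym (insert↭ x ys)) (y≺x ∷ y≺ys)
                ∷ insert-sorted vx vys (λ x∈ys → x∉y∷ys (there x∈ys)) ys-sorted
      where
      y≺x : y ≺ x
      y≺x with ≺-tri vx vy
      ... | inj₁ x≺y        = contradiction (trans (sym x≺y) x≺ᵇy) λ ()
      ... | inj₂ (inj₁ x≡y) = contradiction (here x≡y) x∉y∷ys
      ... | inj₂ (inj₂ y≺x) = y≺x

    sort-sorted : ∀ {xs} → All V xs → Unique xs → Sorted (sort xs)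
    sort-sorted {[]}     []         []              = []
    sort-sorted {x ∷ xs} (vx ∷ vxs) (x≢xs ∷ xs-unique) =
      insert-sorted vx (All-resp-↭ (↭-sym (sort↭ xs)) vxs)
        (λ x∈sort → All.lookup x≢xs (∈-resp-↭ (sort↭ xs) x∈sort) refl)
        (sort-sorted vxs xs-unique)

    Consecutive : A → A → Set
    Consecutive x y = x ≺ y × (∀ {z} → V z → x ≺ z → ¬ z ≺ y)

    sorted-covering⇒linked : ∀ {xs} → Sorted xs → (∀ {z} → V z → z ∈ xs ⊎ All (z ≺_) xs) →
      Linked Consecutive xs
    sorted-covering⇒linked []             _     = []
    sorted-covering⇒linked (_ ∷ [])       _     = [-]
    sorted-covering⇒linked {x ∷ y ∷ xs} (x≺y∷xs ∷ y∷xs-sorted@(y≺xs ∷ _)) covers =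
      (All.head x≺y∷xs , nothing-between) ∷ sorted-covering⇒linked y∷xs-sorted covers′
      where
      nothing-between : ∀ {z} → V z → x ≺ z → ¬ z ≺ y
      nothing-between vz x≺z z≺y with covers vz
      ... | inj₁ (here refl)             = ≺-irrefl x≺z
      ... | inj₁ (there (here refl))     = ≺-irrefl z≺y
      ... | inj₁ (there (there z∈xs))    = ≺-asym (All.lookup y≺xs z∈xs) z≺y
      ... | inj₂ (z≺x ∷ _)               = ≺-asym x≺z z≺x
      covers′ : ∀ {z} → V z → z ∈ y ∷ xs ⊎ All (z ≺_) (y ∷ xs)
      covers′ vz with covers vz
      ... | inj₁ (here refl)  = inj₂ x≺y∷xs
      ... | inj₁ (there z∈)   = inj₁ z∈
      ... | inj₂ (_ ∷ z≺y∷xs) = inj₂ z≺y∷xs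

    sorted-complete⇒linked : ∀ {xs} → Sorted xs → (∀ {z} → V z → z ∈ xs) → Linked Consecutive xs
    sorted-complete⇒linked xs-sorted complete = sorted-covering⇒linked xs-sorted (λ vz → inj₁ (complete vz))

    consecutive-unique : ∀ {x y y′} → V y → V y′ → Consecutive x y → Consecutive x y′ → y ≡ y′
    consecutive-unique vy vy′ (x≺y , y-next) (x≺y′ , y′-next) with ≺-tri vy vy′
    ... | inj₁ y≺y′        = contradiction y≺y′ (y′-next vy x≺y)
    ... | inj₂ (inj₁ y≡y′) = y≡y′
    ... | inj₂ (inj₂ y′≺y) = contradiction y′≺y (y-next vy′ x≺y′)

-- The crossings of γ for coprime a = a′ + 1 and b = b′ + 1

module SignSequence (a′ b′ : ℕ) (coprime : Coprime (suc a′) (suc b′)) where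

  open Geometry (suc a′) (suc b′) public

  a b s : ℕ
  a = suc a′
  b = suc b′
  s = a + b

  Valid : Crossing → Set
  Valid c = 0 < idx c × idx c < den (kind c)

  module Sort = InsertionSort before
  open Sort public using (_≺_; Sorted; []; _∷_)

  0<den : ∀ K → 0 < den K
  0<den vert  = z<s
  0<den horiz = z<s
  0<den diag  = z<s

  ≺⇒< : ∀ x y → x ≺ y → idx x * den (kind y) < idx y * den (kind x)
  ≺⇒< _ _ = <ᵇ≡true⇒<

  <⇒≺ : ∀ x y → idx x * den (kind y) < idx y * den (kind x) → x ≺ y
  <⇒≺ _ _ = <⇒<ᵇ≡true

  ≺-irrefl : ∀ {x} → ¬ x ≺ x
  ≺-irrefl {x} x≺x = <-irrefl refl (≺⇒< x x x≺x)

  ≺-trans : ∀ {x y z} → x ≺ y → y ≺ z → x ≺ z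
  ≺-trans {x} {y} {z} x≺y y≺z = <⇒≺ x z (cross-<-trans (idx x) (idx y) (idx z)
    (0<den (kind x)) (0<den (kind z)) (≺⇒< x y x≺y) (≺⇒< y z y≺z))

  coprime-ba : Coprime b a
  coprime-ba = coprime-sym coprime

  coprime-sa : Coprime s a
  coprime-sa = coprime-+ coprime-ba

  coprime-sb : Coprime s b
  coprime-sb = subst (λ t → Coprime t b) (+-comm b a) (coprime-+ coprime)

  same-parameter⇒≡ : ∀ {x y} → Valid x → Valid y →
    idx x * den (kind y) ≡ idx y * den (kind x) → x ≡ y
  same-parameter⇒≡ {mkCrossing vert k}  {mkCrossing vert k′}  _ _ eq =
    cong (mkCrossing vert) (*-cancelʳ-≡ k k′ b eq)
  same-parameter⇒≡ {mkCrossing horiz k} {mkCrossing horiz k′} _ _ eq =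
    cong (mkCrossing horiz) (*-cancelʳ-≡ k k′ a eq)
  same-parameter⇒≡ {mkCrossing diag k}  {mkCrossing diag k′}  _ _ eq =
    cong (mkCrossing diag) (*-cancelʳ-≡ k k′ s eq)
  same-parameter⇒≡ {mkCrossing vert k}  {mkCrossing horiz k′} (0<k , k<b) _ eq =
    contradiction eq (coprime⇒*≢* coprime-ba k′ 0<k k<b)
  same-parameter⇒≡ {mkCrossing vert k}  {mkCrossing diag k′}  (0<k , k<b) _ eq =
    contradiction eq (coprime⇒*≢* (coprime-sym coprime-sb) k′ 0<k k<b)
  same-parameter⇒≡ {mkCrossing horiz k} {mkCrossing vert k′}  (0<k , k<a) _ eq =
    contradiction eq (coprime⇒*≢* coprime k′ 0<k k<a)
  same-parameter⇒≡ {mkCrossing horiz k} {mkCrossing diag k′}  (0<k , k<a) _ eq =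
    contradiction eq (coprime⇒*≢* (coprime-sym coprime-sa) k′ 0<k k<a)
  same-parameter⇒≡ {mkCrossing diag k}  {mkCrossing vert k′}  (0<k , k<s) _ eq =
    contradiction eq (coprime⇒*≢* coprime-sb k′ 0<k k<s)
  same-parameter⇒≡ {mkCrossing diag k}  {mkCrossing horiz k′} (0<k , k<s) _ eq =
    contradiction eq (coprime⇒*≢* coprime-sa k′ 0<k k<s)

  ≺-tri : ∀ {x y} → Valid x → Valid y → x ≺ y ⊎ x ≡ y ⊎ y ≺ x
  ≺-tri {x} {y} vx vy with <-cmp (idx x * den (kind y)) (idx y * den (kind x))
  ... | tri< lt _ _ = inj₁ (<⇒≺ x y lt)
  ... | tri≈ _ eq _ = inj₂ (inj₁ (same-parameter⇒≡ vx vy eq))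
  ... | tri> _ _ gt = inj₂ (inj₂ (<⇒≺ y x gt))

  open Sort.StrictTotalOn Valid (λ {x} → ≺-irrefl {x}) (λ {x} {y} {z} → ≺-trans {x} {y} {z})
    (λ {x} {y} → ≺-tri {x} {y}) public

  insert≡Sort-insert : ∀ c cs → insert c cs ≡ Sort.insert c cs
  insert≡Sort-insert c []       = refl
  insert≡Sort-insert c (x ∷ cs) with before c x
  ... | true  = refl
  ... | false = cong (x ∷_) (insert≡Sort-insert c cs)

  sort≡Sort-sort : ∀ cs → sort cs ≡ Sort.sort cs
  sort≡Sort-sort []       = refl
  sort≡Sort-sort (c ∷ cs) =
    trans (insert≡Sort-insert c (sort cs)) (cong (Sort.insert c) (sort≡Sort-sort cs))

  family : Kind → ℕ → List Crossing
  family K n = map (mkCrossing K) (range1 n)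

  allCrossings : List Crossing
  allCrossings = family vert b ++ family horiz a ++ family diag s

  ∈-family⁻ : ∀ {z} K n → z ∈ family K (suc n) → kind z ≡ K × 0 < idx z × idx z < suc n
  ∈-family⁻ K n z∈ with ∈-map⁻ (mkCrossing K) z∈
  ... | _ , k∈ , refl with ∈-map⁻ suc k∈
  ...   | _ , i∈ , refl = refl , z<s , s<s (∈-upTo⁻ i∈)

  ∈-family⁺ : ∀ {K n k} → 0 < k → k < suc n → mkCrossing K k ∈ family K (suc n)
  ∈-family⁺ {K} {k = suc k} _ (s<s k<n) = ∈-map⁺ (mkCrossing K) (∈-map⁺ suc (∈-upTo⁺ k<n))

  ∈-allCrossings⁻ : ∀ {z} → z ∈ allCrossings → Valid z
  ∈-allCrossings⁻ z∈ with ∈-++⁻ (family vert b) z∈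
  ... | inj₁ z∈v with ∈-family⁻ vert b′ z∈v
  ...   | refl , valid = valid
  ∈-allCrossings⁻ z∈ | inj₂ z∈hd with ∈-++⁻ (family horiz a) z∈hd
  ...   | inj₁ z∈h with ∈-family⁻ horiz a′ z∈h
  ...     | refl , valid = valid
  ∈-allCrossings⁻ z∈ | inj₂ z∈hd | inj₂ z∈d with ∈-family⁻ diag (a′ + b) z∈d
  ...     | refl , valid = valid

  ∈-allCrossings⁺ : ∀ {z} → Valid z → z ∈ allCrossings
  ∈-allCrossings⁺ {mkCrossing vert k}  (0<k , k<b) = ∈-++⁺ˡ (∈-family⁺ 0<k k<b)
  ∈-allCrossings⁺ {mkCrossing horiz k} (0<k , k<a) = ∈-++⁺ʳ (family vert b) (∈-++⁺ˡ (∈-family⁺ 0<k k<a))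
  ∈-allCrossings⁺ {mkCrossing diag k}  (0<k , k<s) =
    ∈-++⁺ʳ (family vert b) (∈-++⁺ʳ (family horiz a) (∈-family⁺ 0<k k<s))

  allCrossings-unique : Unique allCrossings
  allCrossings-unique = Unique.++⁺ (family-unique vert b)
    (Unique.++⁺ (family-unique horiz a) (family-unique diag s) (disjoint (λ ())))
    vert∉rest
    where
    family-unique : ∀ K n → Unique (family K n)
    family-unique K n = Unique.map⁺ (λ { refl → refl }) (Unique.map⁺ suc-injective (Unique.upTo⁺ _))
    disjoint : ∀ {K K′ n n′} → K ≢ K′ → ∀ {z} → ¬ (z ∈ family K (suc n) × z ∈ family K′ (suc n′))
    disjoint K≢K′ (z∈ , z∈′) = K≢K′ (trans (sym (proj₁ (∈-family⁻ _ _ z∈))) (proj₁ (∈-family⁻ _ _ z∈′)))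
    vert∉rest : ∀ {z} → ¬ (z ∈ family vert b × z ∈ family horiz a ++ family diag s)
    vert∉rest (z∈v , z∈rest) with ∈-++⁻ (family horiz a) z∈rest
    ... | inj₁ z∈h = disjoint (λ ()) (z∈v , z∈h)
    ... | inj₂ z∈d = disjoint (λ ()) (z∈v , z∈d)

  crossings≡sort : crossings ≡ Sort.sort allCrossings
  crossings≡sort = sort≡Sort-sort allCrossings

  crossings↭ : crossings ↭ allCrossings
  crossings↭ = subst (_↭ allCrossings) (sym crossings≡sort) (Sort.sort↭ allCrossings)

  crossings-sorted : Sorted crossings
  crossings-sorted = subst Sorted (sym crossings≡sort)
    (sort-sorted (All.tabulate ∈-allCrossings⁻) allCrossings-unique)

  ∈-crossings⁻ : ∀ {z} → z ∈ crossings → Valid z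
  ∈-crossings⁻ z∈ = ∈-allCrossings⁻ (∈-resp-↭ crossings↭ z∈)

  ∈-crossings⁺ : ∀ {z} → Valid z → z ∈ crossings
  ∈-crossings⁺ valid = ∈-resp-↭ (↭-sym crossings↭) (∈-allCrossings⁺ valid)

  crossings-linked : Linked Consecutive crossings
  crossings-linked = sorted-complete⇒linked crossings-sorted ∈-crossings⁺

  endpoint₁ endpoint₂ : Crossing → Point
  endpoint₁ c = proj₁ (endpoints c)
  endpoint₂ c = proj₂ (endpoints c)

  floor<k : ∀ {k} → 0 < k → k * b / s < k
  floor<k {k} 0<k = *-cancelˡ-< s (k * b / s) k (begin-strict
    s * (k * b / s)  ≡⟨ *-comm s _ ⟩
    k * b / s * s    ≤⟨ m/n*n≤m (k * b) s ⟩
    k * b            <⟨ *-monoʳ-< k {{>-nonZero 0<k}} (m<n+m b z<s) ⟩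
    k * s            ≡⟨ *-comm k s ⟩
    s * k            ∎)
    where open ≤-Reasoning

  equidistant⇒halfway : ∀ c → Valid c → dist2 c (endpoint₁ c) ≡ dist2 c (endpoint₂ c) →
    2 * idx c ≡ den (kind c)
  equidistant⇒halfway (mkCrossing vert k) (0<k , k<b) equidistant =
    equidistant⇒2k≡d coprime-ba 0<k k<b (*-self-injective (+-cancelˡ-≡ _ _ _ equidistant))
  equidistant⇒halfway (mkCrossing horiz k) (0<k , k<a) equidistant =
    equidistant⇒2k≡d coprime 0<k k<a (*-self-injective (+-cancelʳ-≡ _ _ _ equidistant))
  equidistant⇒halfway (mkCrossing diag k) (0<k , k<s) equidistant =
    equidistant⇒2k≡d coprime-sb 0<k k<s (*-self-injective (+-self-injective (begin
      U * U + U * U                                      ≡⟨ cong (λ t → U * U + t * t) (dy≡dx (<⇒≤ m<k)) ⟨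
      U * U + ∣ k * a - s * (k ∸ m) ∣ * ∣ k * a - s * (k ∸ m) ∣  ≡⟨ equidistant ⟩
      W * W + ∣ k * a - s * (k ∸ suc m) ∣ * ∣ k * a - s * (k ∸ suc m) ∣ ≡⟨ cong (λ t → W * W + t * t) (dy≡dx m<k) ⟩
      W * W + W * W                                      ∎)))
    where
    open ≡-Reasoning
    m : ℕ
    m = k * b / s
    m<k : m < k
    m<k = floor<k 0<k
    U W : ℕ
    U = ∣ k * b - s * m ∣
    W = ∣ k * b - s * suc m ∣
    dy≡dx : ∀ {j} → j ≤ k → ∣ k * a - s * (k ∸ j) ∣ ≡ ∣ k * b - s * j ∣
    dy≡dx {j} j≤k = trans (∣-∣-shift _ _ (s * j) (k * b) (begin
      k * a + k * b        ≡⟨ *-distribˡ-+ k a b ⟨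
      k * s                ≡⟨ *-comm k s ⟩
      s * k                ≡⟨ cong (s *_) (m+[n∸m]≡n j≤k) ⟨
      s * (j + (k ∸ j))    ≡⟨ *-distribˡ-+ s j (k ∸ j) ⟩
      s * j + s * (k ∸ j)  ∎)) (∣-∣-comm (s * j) (k * b))

  before-halfway : ∀ c → 0 < idx c → 2 * idx c ≡ den (kind c) →
    ∀ y → before y c ≡ (2 * idx y <ᵇ den (kind y))
  before-halfway c 0<k 2k≡d y = <ᵇ-cong {m′ = 2 * idx y} {n′ = den (kind y)}
    (λ lt → *-cancelʳ-< k _ _ (subst₂ _<_ y-side c-side lt))
    (λ lt → subst₂ _<_ (sym y-side) (sym c-side) (*-monoˡ-< k {{>-nonZero 0<k}} lt))
    where
    k : ℕ
    k = idx c
    y-side : idx y * den (kind c) ≡ 2 * idx y * k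
    y-side = trans (cong (idx y *_) (sym 2k≡d)) (swap-factors (idx y) k)
      where
      swap-factors : ∀ x k → x * (2 * k) ≡ 2 * x * k
      swap-factors = solve-∀
    c-side : k * den (kind y) ≡ den (kind y) * k
    c-side = *-comm k (den (kind y))

  count-family-below-half : ∀ K n → den K ≡ suc n →
    count (λ y → 2 * idx y <ᵇ den (kind y)) (family K (suc n)) ≡ ⌊ n /2⌋
  count-family-below-half K n d≡1+n = begin
    count (λ y → 2 * idx y <ᵇ den (kind y)) (family K (suc n))
      ≡⟨ count-map _ (mkCrossing K) (range1 (suc n)) ⟩
    count (λ k → 2 * k <ᵇ den K) (range1 (suc n))
      ≡⟨ cong (λ d → count (λ k → 2 * k <ᵇ d) (range1 (suc n))) d≡1+n ⟩
    count (λ k → 2 * k <ᵇ suc n) (range1 (suc n))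
      ≡⟨ count-below-half n ⟩
    ⌊ n /2⌋
      ∎
    where open ≡-Reasoning

  halfway-position : ∀ {j c} → crossings !? j ≡ just c → 2 * idx c ≡ den (kind c) → j ≡ a′ + b′
  halfway-position {j} {c} c-at-j halfway = begin
    j                                         ≡⟨ count-≺-sorted crossings j crossings-sorted c-at-j ⟨
    count (λ y → before y c) crossings        ≡⟨ count-resp-↭ _ crossings↭ ⟩
    count (λ y → before y c) allCrossings     ≡⟨ count-cong (before-halfway c 0<k halfway) allCrossings ⟩
    count below-half allCrossings             ≡⟨ count-++ below-half (family vert b) _ ⟩
    count below-half (family vert b) + count below-half (family horiz a ++ family diag s)
      ≡⟨ cong (count below-half (family vert b) +_) (count-++ below-half (family horiz a) _) ⟩
    count below-half (family vert b) + (count below-half (family horiz a) + count below-half (family diag s))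
      ≡⟨ cong₂ _+_ (count-family-below-half vert b′ refl)
           (cong₂ _+_ (count-family-below-half horiz a′ refl) (count-family-below-half diag (a′ + b) refl)) ⟩
    ⌊ b′ /2⌋ + (⌊ a′ /2⌋ + ⌊ a′ + b /2⌋)      ≡⟨ sum-of-halves a′ b′ coprime ⟩
    a′ + b′                                   ∎
    where
    open ≡-Reasoning
    0<k : 0 < idx c
    0<k = proj₁ (∈-crossings⁻ (!?⇒∈ crossings j c-at-j))
    below-half : Crossing → Bool
    below-half y = 2 * idx y <ᵇ den (kind y)

  crossSign-mid-irrelevant : ∀ c → Valid c → 2 * idx c ≢ den (kind c) →
    ∀ mid mid′ → crossSign mid c ≡ crossSign mid′ c
  crossSign-mid-irrelevant c valid not-halfway mid mid′
    with dist2 c (endpoint₁ c) <ᵇ dist2 c (endpoint₂ c) in d₁<ᵇd₂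
       | dist2 c (endpoint₂ c) <ᵇ dist2 c (endpoint₁ c) in d₂<ᵇd₁
  ... | true  | _     = refl
  ... | false | true  = refl
  ... | false | false = contradiction
    (equidistant⇒halfway c valid (≤-antisym (<ᵇ≡false⇒≥ d₂<ᵇd₁) (<ᵇ≡false⇒≥ d₁<ᵇd₂))) not-halfway

  body-mid-irrelevant : ∀ mid mid′ cs zs i →
    (∀ j {c} → cs !? j ≡ just c → 2 * j ≡ i → crossSign mid c ≡ crossSign mid′ c) →
    (body mid cs ++ zs) !? i ≡ (body mid′ cs ++ zs) !? i
  body-mid-irrelevant mid mid′ []           zs i             _     = refl
  body-mid-irrelevant mid mid′ (c ∷ [])     zs zero          agree = cong just (agree 0 refl refl)
  body-mid-irrelevant mid mid′ (c ∷ [])     zs (suc i)       _     = refl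
  body-mid-irrelevant mid mid′ (c ∷ _ ∷ _)  zs zero          agree = cong just (agree 0 refl refl)
  body-mid-irrelevant mid mid′ (c ∷ _ ∷ _)  zs (suc zero)    _     = refl
  body-mid-irrelevant mid mid′ (c ∷ c′ ∷ cs) zs (suc (suc i)) agree =
    body-mid-irrelevant mid mid′ (c′ ∷ cs) zs i
      (λ j c-at-j 2j≡i → agree (suc j) c-at-j (trans (*-suc 2 j) (cong (2 +_) 2j≡i)))

  centre≡ : 2 * (a + b) ∸ 3 ≡ suc (2 * (a′ + b′))
  centre≡ = trans (cong (_∸ 3) (expand a′ b′)) (m+n∸m≡n 3 _)
    where
    expand : ∀ a′ b′ → 2 * (suc a′ + suc b′) ≡ 3 + suc (2 * (a′ + b′))
    expand = solve-∀

  seq-mid-irrelevant : ∀ mid mid′ i → i ≢ 2 * (a + b) ∸ 3 → seq mid !? i ≡ seq mid′ !? i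
  seq-mid-irrelevant mid mid′ zero    _          = refl
  seq-mid-irrelevant mid mid′ (suc i) not-centre =
    body-mid-irrelevant mid mid′ crossings [ endSign ] i λ j {c} c-at-j 2j≡i →
      crossSign-mid-irrelevant c (∈-crossings⁻ (!?⇒∈ crossings j c-at-j))
        (λ halfway → not-centre (begin
          suc i                  ≡⟨ cong suc 2j≡i ⟨
          suc (2 * j)            ≡⟨ cong (λ t → suc (2 * t)) (halfway-position c-at-j halfway) ⟩
          suc (2 * (a′ + b′))    ≡⟨ centre≡ ⟨
          2 * (a + b) ∸ 3        ∎))
        mid mid′
    where open ≡-Reasoning

  OffLine : Point → Set
  OffLine (x , y) = a * x ≢ b * y

  _∈ᵉ_ : Point → Crossing → Bool
  X ∈ᵉ c = pointEq X (endpoint₁ c) ∨ pointEq X (endpoint₂ c)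

  commonEndpoint≡ : ∀ c c′ → commonEndpoint c c′ ≡ (if endpoint₁ c ∈ᵉ c′ then endpoint₁ c else endpoint₂ c)
  commonEndpoint≡ c c′ = sym (if-∨ (pointEq (endpoint₁ c) (endpoint₁ c′)))

  SharesOneEndpoint : Crossing → Crossing → Set
  SharesOneEndpoint c c′ = (endpoint₁ c ∈ᵉ c′ ≡ true × endpoint₂ c ∈ᵉ c′ ≡ false)
                         ⊎ (endpoint₁ c ∈ᵉ c′ ≡ false × endpoint₂ c ∈ᵉ c′ ≡ true)

  -- The segment of the diagonal crossing at k/(a+b) joins (m, n+1) and (m+1, n). Afterwards γ
  -- meets x = m+1 at (m+1)/b and y = n+1 at (n+1)/a; the next diagonal, at (k+1)/(a+b), is the
  -- mediant of these two and so never comes first.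
  module DiagonalCrossing {k : ℕ} (valid : Valid (mkCrossing diag k)) where

    c : Crossing
    c = mkCrossing diag k

    m n : ℕ
    m = k * b / s
    n = k ∸ suc m

    0<k : 0 < k
    0<k = proj₁ valid

    k<s : k < s
    k<s = proj₂ valid

    m<k : m < k
    m<k = floor<k 0<k

    k≡m+1+n : k ≡ m + suc n
    k≡m+1+n = sym (trans (+-suc m n) (m+[n∸m]≡n m<k))

    k∸m≡1+n : k ∸ m ≡ suc n
    k∸m≡1+n = trans (cong (_∸ m) k≡m+1+n) (m+n∸m≡n m (suc n))

    k∸n≡1+m : k ∸ n ≡ suc m
    k∸n≡1+m = m∸[m∸n]≡n m<k

    k∸1+n≡m : k ∸ suc n ≡ m
    k∸1+n≡m = trans (cong (_∸ suc n) k≡m+1+n) (m+n∸n≡m m (suc n))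

    sm<kb : s * m < k * b
    sm<kb = ≤∧≢⇒< (subst (_≤ k * b) (*-comm m s) (m/n*n≤m (k * b) s))
      λ sm≡kb → coprime⇒*≢* coprime-sb m 0<k k<s (trans (sym sm≡kb) (*-comm s m))

    kb<[1+m]s : k * b < suc m * s
    kb<[1+m]s = m<[1+m/n]*n (k * b) s

    split-k : ∀ x → k * x ≡ m * x + suc n * x
    split-k x = trans (cong (_* x) k≡m+1+n) (*-distribʳ-+ x m (suc n))

    split-k′ : ∀ x → k * x ≡ suc m * x + n * x
    split-k′ x = trans (split-k x) (shift m n x)
      where
      shift : ∀ m n x → m * x + suc n * x ≡ suc m * x + n * x
      shift = solve-∀

    split-s : ∀ x → x * s ≡ x * a + x * b
    split-s x = *-distribˡ-+ x a b

    ma<[1+n]b : m * a < suc n * b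
    ma<[1+n]b = +-cancelʳ-< (m * b) (m * a) (suc n * b) (begin-strict
      m * a + m * b       ≡⟨ split-s m ⟨
      m * s               ≡⟨ *-comm m s ⟩
      s * m               <⟨ sm<kb ⟩
      k * b               ≡⟨ split-k b ⟩
      m * b + suc n * b   ≡⟨ +-comm (m * b) _ ⟩
      suc n * b + m * b   ∎)
      where open ≤-Reasoning

    nb<[1+m]a : n * b < suc m * a
    nb<[1+m]a = +-cancelˡ-< (suc m * b) (n * b) (suc m * a) (begin-strict
      suc m * b + n * b       ≡⟨ split-k′ b ⟨
      k * b                   <⟨ kb<[1+m]s ⟩
      suc m * s               ≡⟨ split-s (suc m) ⟩
      suc m * a + suc m * b   ≡⟨ +-comm (suc m * a) _ ⟩
      suc m * b + suc m * a   ∎)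
      where open ≤-Reasoning

    ns<ka : n * s < k * a
    ns<ka = begin-strict
      n * s               ≡⟨ split-s n ⟩
      n * a + n * b       <⟨ +-monoʳ-< (n * a) nb<[1+m]a ⟩
      n * a + suc m * a   ≡⟨ +-comm (n * a) _ ⟩
      suc m * a + n * a   ≡⟨ split-k′ a ⟨
      k * a               ∎
      where open ≤-Reasoning

    ka<[1+n]s : k * a < suc n * s
    ka<[1+n]s = begin-strict
      k * a                   ≡⟨ split-k a ⟩
      m * a + suc n * a       <⟨ +-monoˡ-< (suc n * a) ma<[1+n]b ⟩
      suc n * b + suc n * a   ≡⟨ +-comm (suc n * b) _ ⟩
      suc n * a + suc n * b   ≡⟨ split-s (suc n) ⟨
      suc n * s               ∎
      where open ≤-Reasoning

    k*a/[b+a]≡n : k * a / (b + a) ≡ n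
    k*a/[b+a]≡n = /-unique (k * a) (b + a) n
      (<⇒≤ (subst (λ t → n * t < k * a) (+-comm a b) ns<ka))
      (subst (λ t → k * a < suc n * t) (+-comm a b) ka<[1+n]s)

    m<b : m < b
    m<b = *-cancelˡ-< s m b (<-trans sm<kb (*-monoˡ-< b k<s))

    n<a : n < a
    n<a = *-cancelʳ-< s n a (<-trans ns<ka (subst (k * a <_) (*-comm s a) (*-monoˡ-< a k<s)))

    vert-after : ∀ {j} → c ≺ mkCrossing vert j → m < j
    vert-after {j} c≺z =
      *-cancelʳ-< s m j (<-trans (subst (_< k * b) (*-comm s m) sm<kb) (≺⇒< c (mkCrossing vert j) c≺z))

    horiz-after : ∀ {j} → c ≺ mkCrossing horiz j → n < j
    horiz-after {j} c≺z = *-cancelʳ-< s n j (<-trans ns<ka (≺⇒< c (mkCrossing horiz j) c≺z))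

    diag-after : ∀ {j} → c ≺ mkCrossing diag j → k < j
    diag-after {j} c≺z = *-cancelʳ-< s k j (≺⇒< c (mkCrossing diag j) c≺z)

    u v : Crossing
    u = mkCrossing vert (suc m)
    v = mkCrossing horiz (suc n)

    split-1+k : ∀ x → suc k * x ≡ suc m * x + suc n * x
    split-1+k x = trans (cong (λ t → suc t * x) k≡m+1+n) (*-distribʳ-+ x (suc m) (suc n))

    mediant-u : suc m * a < suc n * b → suc m * s < suc k * b
    mediant-u X<Y = begin-strict
      suc m * s               ≡⟨ split-s (suc m) ⟩
      suc m * a + suc m * b   <⟨ +-monoˡ-< (suc m * b) X<Y ⟩
      suc n * b + suc m * b   ≡⟨ +-comm (suc n * b) _ ⟩
      suc m * b + suc n * b   ≡⟨ split-1+k b ⟨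
      suc k * b               ∎
      where open ≤-Reasoning

    mediant-v : suc n * b < suc m * a → suc n * s < suc k * a
    mediant-v Y<X = begin-strict
      suc n * s               ≡⟨ split-s (suc n) ⟩
      suc n * a + suc n * b   <⟨ +-monoʳ-< (suc n * a) Y<X ⟩
      suc n * a + suc m * a   ≡⟨ +-comm (suc n * a) _ ⟩
      suc m * a + suc n * a   ≡⟨ split-1+k a ⟨
      suc k * a               ∎
      where open ≤-Reasoning

    u-valid : suc m * a < suc n * b → Valid u
    u-valid X<Y = z<s , *-cancelʳ-< a (suc m) b
      (<-≤-trans X<Y (subst (suc n * b ≤_) (*-comm a b) (*-monoˡ-≤ b n<a)))

    v-valid : suc n * b < suc m * a → Valid v
    v-valid Y<X = z<s , *-cancelʳ-< b (suc n) a
      (<-≤-trans Y<X (subst (suc m * a ≤_) (*-comm b a) (*-monoˡ-≤ a m<b)))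

    c⋯u : suc m * a < suc n * b → Consecutive c u
    c⋯u X<Y = <⇒≺ c u kb<[1+m]s , λ {z} → nothing-between {z}
      where
      nothing-between : ∀ {z} → Valid z → c ≺ z → ¬ z ≺ u
      nothing-between {mkCrossing vert j} _ c≺z z≺u =
        <⇒≱ (*-cancelʳ-< b j (suc m) (≺⇒< (mkCrossing vert j) u z≺u)) (vert-after {j} c≺z)
      nothing-between {mkCrossing horiz j} _ c≺z z≺u =
        <⇒≱ (<-trans (≺⇒< (mkCrossing horiz j) u z≺u) X<Y) (*-monoˡ-≤ b (horiz-after {j} c≺z))
      nothing-between {mkCrossing diag j} _ c≺z z≺u =
        <⇒≱ (<-trans (≺⇒< (mkCrossing diag j) u z≺u) (mediant-u X<Y)) (*-monoˡ-≤ b (diag-after {j} c≺z))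

    c⋯v : suc n * b < suc m * a → Consecutive c v
    c⋯v Y<X = <⇒≺ c v ka<[1+n]s , λ {z} → nothing-between {z}
      where
      nothing-between : ∀ {z} → Valid z → c ≺ z → ¬ z ≺ v
      nothing-between {mkCrossing vert j} _ c≺z z≺v =
        <⇒≱ (<-trans (≺⇒< (mkCrossing vert j) v z≺v) Y<X) (*-monoˡ-≤ a (vert-after {j} c≺z))
      nothing-between {mkCrossing horiz j} _ c≺z z≺v =
        <⇒≱ (*-cancelʳ-< a j (suc n) (≺⇒< (mkCrossing horiz j) v z≺v)) (horiz-after {j} c≺z)
      nothing-between {mkCrossing diag j} _ c≺z z≺v =
        <⇒≱ (<-trans (≺⇒< (mkCrossing diag j) v z≺v) (mediant-v Y<X)) (*-monoˡ-≤ a (diag-after {j} c≺z))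

    last-crossing : suc m * a ≡ suc n * b → ∀ {z} → Valid z → ¬ c ≺ z
    last-crossing X≡Y {mkCrossing vert j}  (_ , j<b) c≺z = <⇒≱ j<b (subst (_≤ j) 1+m≡b (vert-after {j} c≺z))
      where
      1+m≡b : suc m ≡ b
      1+m≡b = ≤-antisym m<b (≮⇒≥ λ 1+m<b → coprime⇒*≢* coprime-ba (suc n) z<s 1+m<b X≡Y)
    last-crossing X≡Y {mkCrossing horiz j} (_ , j<a) c≺z = <⇒≱ j<a (subst (_≤ j) 1+n≡a (horiz-after {j} c≺z))
      where
      1+n≡a : suc n ≡ a
      1+n≡a = ≤-antisym n<a (≮⇒≥ λ 1+n<a → coprime⇒*≢* coprime (suc m) z<s 1+n<a (sym X≡Y))
    last-crossing X≡Y {mkCrossing diag j}  (_ , j<s) c≺z = <⇒≱ j<s (subst (_≤ j) 1+k≡s (diag-after {j} c≺z))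
      where
      1+m≡b : suc m ≡ b
      1+m≡b = ≤-antisym m<b (≮⇒≥ λ 1+m<b → coprime⇒*≢* coprime-ba (suc n) z<s 1+m<b X≡Y)
      1+n≡a : suc n ≡ a
      1+n≡a = ≤-antisym n<a (≮⇒≥ λ 1+n<a → coprime⇒*≢* coprime (suc m) z<s 1+n<a (sym X≡Y))
      1+k≡s : suc k ≡ s
      1+k≡s = trans (cong suc k≡m+1+n) (trans (cong₂ _+_ 1+m≡b 1+n≡a) (+-comm b a))

    u-shares-endpoint₂ : suc m * a < suc n * b → endpoint₁ c ∈ᵉ u ≡ false × endpoint₂ c ∈ᵉ u ≡ true
    u-shares-endpoint₂ X<Y rewrite /-unique (suc m * a) b n (<⇒≤ nb<[1+m]a) X<Y
      | n≡ᵇ1+n m | ≡ᵇ-refl m | ≡ᵇ-refl n = refl , refl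

    v-shares-endpoint₁ : suc n * b < suc m * a → endpoint₁ c ∈ᵉ v ≡ true × endpoint₂ c ∈ᵉ v ≡ false
    v-shares-endpoint₁ Y<X rewrite /-unique (suc n * b) a m (<⇒≤ ma<[1+n]b) Y<X | k∸m≡1+n
      | ≡ᵇ-refl m | ≡ᵇ-refl n | 1+n≡ᵇn m | n≡ᵇ1+n n = refl , refl

    successor-shares-one-endpoint : ∀ {c′} → Valid c′ → Consecutive c c′ → SharesOneEndpoint c c′
    successor-shares-one-endpoint {c′} valid′ c⋯c′ with <-cmp (suc m * a) (suc n * b)
    ... | tri< X<Y _ _ = subst (SharesOneEndpoint c)
      (consecutive-unique {c} {u} {c′} (u-valid X<Y) valid′ (c⋯u X<Y) c⋯c′) (inj₂ (u-shares-endpoint₂ X<Y))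
    ... | tri≈ _ X≡Y _ = ⊥-elim (last-crossing X≡Y {c′} valid′ (proj₁ c⋯c′))
    ... | tri> _ _ Y<X = subst (SharesOneEndpoint c)
      (consecutive-unique {c} {v} {c′} (v-valid Y<X) valid′ (c⋯v Y<X) c⋯c′) (inj₁ (v-shares-endpoint₁ Y<X))

  endpoints-off-line : ∀ c → Valid c → OffLine (endpoint₁ c) × OffLine (endpoint₂ c)
  endpoints-off-line (mkCrossing vert k) (0<k , k<b) = off , off
    where
    off : ∀ {y} → a * k ≢ b * y
    off {y} ak≡by = coprime⇒*≢* coprime-ba y 0<k k<b (trans (*-comm k a) (trans ak≡by (*-comm b y)))
  endpoints-off-line (mkCrossing horiz k) (0<k , k<a) = off , off
    where
    off : ∀ {x} → a * x ≢ b * k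
    off {x} ax≡bk = coprime⇒*≢* coprime x 0<k k<a (trans (*-comm k b) (trans (sym ax≡bk) (*-comm a x)))
  endpoints-off-line (mkCrossing diag k) valid@(0<k , k<s) = off (<⇒≤ D.m<k) , off D.m<k
    where
    module D = DiagonalCrossing valid
    off : ∀ {x} → x ≤ k → a * x ≢ b * (k ∸ x)
    off {x} x≤k ax≡b[k∸x] = coprime⇒*≢* coprime-sb x 0<k k<s (begin
      k * b                 ≡⟨ *-comm k b ⟩
      b * k                 ≡⟨ cong (b *_) (m∸n+n≡m x≤k) ⟨
      b * (k ∸ x + x)       ≡⟨ *-distribˡ-+ b (k ∸ x) x ⟩
      b * (k ∸ x) + b * x   ≡⟨ cong (_+ b * x) ax≡b[k∸x] ⟨
      a * x + b * x         ≡⟨ *-distribʳ-+ x a b ⟨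
      s * x                 ≡⟨ *-comm s x ⟩
      x * s                 ∎)
      where open ≡-Reasoning

  commonEndpoint-off-line : ∀ c c′ → Valid c → OffLine (commonEndpoint c c′)
  commonEndpoint-off-line c c′ valid rewrite commonEndpoint≡ c c′ with endpoint₁ c ∈ᵉ c′
  ... | true  = proj₁ (endpoints-off-line c valid)
  ... | false = proj₂ (endpoints-off-line c valid)

-- Reflection in the line y = x

-- crossSign mid c unfolds to nearestSign (dist2 c) sideSign mid (endpoints c).
nearestSign : (Point → ℕ) → (Point → Sign) → Sign → Point × Point → Sign
nearestSign d side mid (X , Y) = if d X <ᵇ d Y then side X else if d Y <ᵇ d X then side Y else mid

nearestSign-swap : ∀ d side mid X Y → nearestSign d side mid (Y , X) ≡ nearestSign d side mid (X , Y)
nearestSign-swap d side mid X Y with d X <ᵇ d Y in dX<ᵇdY | d Y <ᵇ d X in dY<ᵇdX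
... | true  | true  = contradiction (<ᵇ≡true⇒< {d Y} {d X} dY<ᵇdX) (<⇒≯ (<ᵇ≡true⇒< {d X} {d Y} dX<ᵇdY))
... | true  | false = refl
... | false | true  = refl
... | false | false = refl

nearestSign-opposite : ∀ {d d′ side side′} mid X Y X′ Y′ → d′ X′ ≡ d X → d′ Y′ ≡ d Y →
  side′ X′ ≡ opposite (side X) → side′ Y′ ≡ opposite (side Y) →
  nearestSign d′ side′ (opposite mid) (X′ , Y′) ≡ opposite (nearestSign d side mid (X , Y))
nearestSign-opposite {d} mid X Y X′ Y′ dX dY sideX sideY rewrite dX | dY | sideX | sideY
  with d X <ᵇ d Y | d Y <ᵇ d X
... | true  | _     = refl
... | false | true  = refl
... | false | false = refl

if-exclusive : ∀ {A : Set} {t u : Bool} (x y : A) → (t ≡ true × u ≡ false) ⊎ (t ≡ false × u ≡ true) →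
  (if u then y else x) ≡ (if t then x else y)
if-exclusive x y (inj₁ (refl , refl)) = refl
if-exclusive x y (inj₂ (refl , refl)) = refl

side-swap : ∀ m n → m ≢ n → (if n <ᵇ m then plus else minus) ≡ opposite (if m <ᵇ n then plus else minus)
side-swap m n m≢n with m <ᵇ n in m<ᵇn | n <ᵇ m in n<ᵇm
... | true  | true  = contradiction (<ᵇ≡true⇒< {n} {m} n<ᵇm) (<⇒≯ (<ᵇ≡true⇒< {m} {n} m<ᵇn))
... | true  | false = refl
... | false | true  = refl
... | false | false = contradiction (≤-antisym (<ᵇ≡false⇒≥ {n} {m} n<ᵇm) (<ᵇ≡false⇒≥ {m} {n} m<ᵇn)) m≢n

reflectKind : Kind → Kind
reflectKind vert  = horiz
reflectKind horiz = vert
reflectKind diag  = diag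

reflect : Crossing → Crossing
reflect (mkCrossing K k) = mkCrossing (reflectKind K) k

reflect-involutive : ∀ c → reflect (reflect c) ≡ c
reflect-involutive (mkCrossing vert k)  = refl
reflect-involutive (mkCrossing horiz k) = refl
reflect-involutive (mkCrossing diag k)  = refl

-- Endpoints are listed lower or left one first, and for a diagonal segment by increasing x;
-- reflection in y = x keeps this order on vertical and horizontal segments but reverses it on
-- diagonal ones.
reflectSegment : Kind → Point × Point → Point × Point
reflectSegment vert  (X , Y) = swap X , swap Y
reflectSegment horiz (X , Y) = swap X , swap Y
reflectSegment diag  (X , Y) = swap Y , swap X

nearestSign-reflectSegment : ∀ K {d side mid} X Y →
  nearestSign d side mid (reflectSegment K (X , Y)) ≡ nearestSign d side mid (swap X , swap Y)
nearestSign-reflectSegment vert  X Y = refl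
nearestSign-reflectSegment horiz X Y = refl
nearestSign-reflectSegment diag {d} {side} {mid} X Y = nearestSign-swap d side mid (swap X) (swap Y)

module Reflection (a′ b′ : ℕ) (coprime : Coprime (suc a′) (suc b′)) where

  module G = SignSequence a′ b′ coprime
  module H = SignSequence b′ a′ (coprime-sym coprime)

  den-reflect : ∀ K → H.den (reflectKind K) ≡ G.den K
  den-reflect vert  = refl
  den-reflect horiz = refl
  den-reflect diag  = +-comm (suc b′) (suc a′)

  before-reflect : ∀ x y → H.before (reflect x) (reflect y) ≡ G.before x y
  before-reflect (mkCrossing K k) (mkCrossing K′ k′) rewrite den-reflect K | den-reflect K′ = refl

  valid-reflect : ∀ c → G.Valid c → H.Valid (reflect c)
  valid-reflect (mkCrossing K k) (0<k , k<d) = 0<k , subst (k <_) (sym (den-reflect K)) k<d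

  valid-reflect⁻ : ∀ c → H.Valid (reflect c) → G.Valid c
  valid-reflect⁻ (mkCrossing K k) (0<k , k<d) = 0<k , subst (k <_) (den-reflect K) k<d

  sorted-reflect : ∀ {cs} → G.Sorted cs → H.Sorted (map reflect cs)
  sorted-reflect G.[] = H.[]
  sorted-reflect {c ∷ _} (c≺cs G.∷ cs-sorted) =
    map⁺ (All.map (λ {y} c≺y → trans (before-reflect c y) c≺y) c≺cs) H.∷ sorted-reflect cs-sorted

  crossings-reflect : H.crossings ≡ map reflect G.crossings
  crossings-reflect = H.sorted-unique H.crossings-sorted (sorted-reflect G.crossings-sorted) H⊆G G⊆H
    where
    H⊆G : ∀ {z} → z ∈ H.crossings → z ∈ map reflect G.crossings
    H⊆G {z} z∈ = subst (_∈ map reflect G.crossings) (reflect-involutive z)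
      (∈-map⁺ reflect (G.∈-crossings⁺ (valid-reflect⁻ (reflect z)
        (subst H.Valid (sym (reflect-involutive z)) (H.∈-crossings⁻ z∈)))))
    G⊆H : ∀ {z} → z ∈ map reflect G.crossings → z ∈ H.crossings
    G⊆H z∈ with ∈-map⁻ reflect z∈
    ... | c , c∈ , refl = H.∈-crossings⁺ (valid-reflect c (G.∈-crossings⁻ c∈))

  dist2-reflect : ∀ c X → H.dist2 (reflect c) (swap X) ≡ G.dist2 c X
  dist2-reflect (mkCrossing K k) (x , y) rewrite den-reflect K =
    +-comm (∣ k * suc a′ - G.den K * y ∣ * ∣ k * suc a′ - G.den K * y ∣)
           (∣ k * suc b′ - G.den K * x ∣ * ∣ k * suc b′ - G.den K * x ∣)

  sideSign-reflect : ∀ X → G.OffLine X → H.sideSign (swap X) ≡ opposite (G.sideSign X)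
  sideSign-reflect (x , y) = side-swap (suc a′ * x) (suc b′ * y)

  private module D = G.DiagonalCrossing

  endpoints-reflect : ∀ c → G.Valid c →
    H.endpoints (reflect c) ≡ reflectSegment (kind c) (G.endpoints c)
  endpoints-reflect (mkCrossing vert k)  _     = refl
  endpoints-reflect (mkCrossing horiz k) _     = refl
  endpoints-reflect (mkCrossing diag k)  valid
    rewrite D.k*a/[b+a]≡n {k} valid | D.k∸n≡1+m {k} valid
          | D.k∸1+n≡m {k} valid | D.k∸m≡1+n {k} valid = refl

  crossSign-reflect : ∀ mid c → G.Valid c →
    H.crossSign (opposite mid) (reflect c) ≡ opposite (G.crossSign mid c)
  crossSign-reflect mid c valid = begin
    H.crossSign (opposite mid) (reflect c)
      ≡⟨ cong (nearestSign (H.dist2 (reflect c)) H.sideSign (opposite mid)) (endpoints-reflect c valid) ⟩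
    nearestSign (H.dist2 (reflect c)) H.sideSign (opposite mid) (reflectSegment (kind c) (P , Q))
      ≡⟨ nearestSign-reflectSegment (kind c) {H.dist2 (reflect c)} {H.sideSign} {opposite mid} P Q ⟩
    nearestSign (H.dist2 (reflect c)) H.sideSign (opposite mid) (swap P , swap Q)
      ≡⟨ nearestSign-opposite {G.dist2 c} {H.dist2 (reflect c)} {G.sideSign} {H.sideSign}
           mid P Q (swap P) (swap Q) (dist2-reflect c P) (dist2-reflect c Q)
           (sideSign-reflect P (proj₁ off)) (sideSign-reflect Q (proj₂ off)) ⟩
    opposite (G.crossSign mid c)
      ∎
    where
    open ≡-Reasoning
    P Q : Point
    P = G.endpoint₁ c
    Q = G.endpoint₂ c
    off : G.OffLine P × G.OffLine Q
    off = G.endpoints-off-line c valid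

  pointEq-reflect : ∀ X Y → H.pointEq (swap X) (swap Y) ≡ G.pointEq X Y
  pointEq-reflect (x , y) (x′ , y′) = ∧-comm (y ≡ᵇ y′) (x ≡ᵇ x′)

  ∈ᵉ-reflect : ∀ X c′ → G.Valid c′ → swap X H.∈ᵉ reflect c′ ≡ X G.∈ᵉ c′
  ∈ᵉ-reflect X c′ valid′ = trans
    (cong (λ e → H.pointEq (swap X) (proj₁ e) ∨ H.pointEq (swap X) (proj₂ e)) (endpoints-reflect c′ valid′))
    (in-segment (kind c′))
    where
    P′ Q′ : Point
    P′ = G.endpoint₁ c′
    Q′ = G.endpoint₂ c′
    in-segment : ∀ K → H.pointEq (swap X) (proj₁ (reflectSegment K (P′ , Q′)))
                       ∨ H.pointEq (swap X) (proj₂ (reflectSegment K (P′ , Q′)))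
                     ≡ G.pointEq X P′ ∨ G.pointEq X Q′
    in-segment vert  = cong₂ _∨_ (pointEq-reflect X P′) (pointEq-reflect X Q′)
    in-segment horiz = cong₂ _∨_ (pointEq-reflect X P′) (pointEq-reflect X Q′)
    in-segment diag  = trans (cong₂ _∨_ (pointEq-reflect X Q′) (pointEq-reflect X P′))
                             (∨-comm (G.pointEq X Q′) (G.pointEq X P′))

  commonEndpoint-reflect : ∀ c c′ → G.Valid c → G.Valid c′ → G.Consecutive c c′ →
    H.commonEndpoint (reflect c) (reflect c′) ≡ swap (G.commonEndpoint c c′)
  commonEndpoint-reflect c c′ valid valid′ c⋯c′ = begin
    H.commonEndpoint (reflect c) (reflect c′)
      ≡⟨ H.commonEndpoint≡ (reflect c) (reflect c′) ⟩
    (if H.endpoint₁ (reflect c) H.∈ᵉ reflect c′ then H.endpoint₁ (reflect c) else H.endpoint₂ (reflect c))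
      ≡⟨ cong (λ e → if proj₁ e H.∈ᵉ reflect c′ then proj₁ e else proj₂ e) (endpoints-reflect c valid) ⟩
    choose (reflectSegment (kind c) (P , Q))
      ≡⟨ choose-reflectSegment c valid c⋯c′ ⟩
    (if P G.∈ᵉ c′ then swap P else swap Q)
      ≡⟨ if-float swap (P G.∈ᵉ c′) ⟨
    swap (if P G.∈ᵉ c′ then P else Q)
      ≡⟨ cong swap (G.commonEndpoint≡ c c′) ⟨
    swap (G.commonEndpoint c c′)
      ∎
    where
    open ≡-Reasoning
    P Q : Point
    P = G.endpoint₁ c
    Q = G.endpoint₂ c
    choose : Point × Point → Point
    choose (X , Y) = if X H.∈ᵉ reflect c′ then X else Y
    choose-reflectSegment : ∀ c → G.Valid c → G.Consecutive c c′ →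
      choose (reflectSegment (kind c) (G.endpoint₁ c , G.endpoint₂ c))
      ≡ (if G.endpoint₁ c G.∈ᵉ c′ then swap (G.endpoint₁ c) else swap (G.endpoint₂ c))
    choose-reflectSegment c@(mkCrossing vert _)  _ _ =
      cong (if_then _ else _) (∈ᵉ-reflect (G.endpoint₁ c) c′ valid′)
    choose-reflectSegment c@(mkCrossing horiz _) _ _ =
      cong (if_then _ else _) (∈ᵉ-reflect (G.endpoint₁ c) c′ valid′)
    choose-reflectSegment c@(mkCrossing diag _)  valid c⋯c′ =
      trans (cong (if_then _ else _) (∈ᵉ-reflect (G.endpoint₂ c) c′ valid′))
        (if-exclusive {t = G.endpoint₁ c G.∈ᵉ c′} {u = G.endpoint₂ c G.∈ᵉ c′} _ _
          (D.successor-shares-one-endpoint valid {c′} valid′ c⋯c′))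

  commonSide-reflect : ∀ c c′ → G.Valid c → G.Valid c′ → G.Consecutive c c′ →
    H.sideSign (H.commonEndpoint (reflect c) (reflect c′)) ≡ opposite (G.sideSign (G.commonEndpoint c c′))
  commonSide-reflect c c′ valid valid′ c⋯c′ =
    trans (cong H.sideSign (commonEndpoint-reflect c c′ valid valid′ c⋯c′))
          (sideSign-reflect (G.commonEndpoint c c′) (G.commonEndpoint-off-line c c′ valid))

  body-reflect : ∀ mid {cs} → All G.Valid cs → Linked G.Consecutive cs →
    H.body (opposite mid) (map reflect cs) ≡ map opposite (G.body mid cs)
  body-reflect mid []                                    []              = refl
  body-reflect mid {c ∷ []}      (valid ∷ _)              [-]             =
    cong (_∷ []) (crossSign-reflect mid c valid)
  body-reflect mid {c ∷ c′ ∷ cs} (valid ∷ valid′ ∷ valids) (c⋯c′ ∷ linked) =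
    cong₂ _∷_ (crossSign-reflect mid c valid)
      (cong₂ _∷_ (commonSide-reflect c c′ valid valid′ c⋯c′) (body-reflect mid (valid′ ∷ valids) linked))

  seq-reflect : a′ < b′ → ∀ mid → H.seq (opposite mid) ≡ map opposite (G.seq mid)
  seq-reflect a′<b′ mid
    rewrite ≥⇒<ᵇ≡false {b′} {suc a′} a′<b′ | <⇒<ᵇ≡true {a′} {suc b′} (m<n⇒m<1+n a′<b′)
          | crossings-reflect =
    cong (plus ∷_) (begin
      H.body (opposite mid) (map reflect G.crossings) ++ [ minus ]
        ≡⟨ cong (_++ [ minus ]) (body-reflect mid (All.tabulate G.∈-crossings⁻) G.crossings-linked) ⟩
      map opposite (G.body mid G.crossings) ++ map opposite [ plus ]
        ≡⟨ map-++ opposite (G.body mid G.crossings) [ plus ] ⟨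
      map opposite (G.body mid G.crossings ++ [ plus ])
        ∎)
    where open ≡-Reasoning

map-!? : ∀ {A B : Set} (f : A → B) xs i → map f xs !? i ≡ Maybe.map f (xs !? i)
map-!? f []       i       = refl
map-!? f (x ∷ xs) zero    = refl
map-!? f (x ∷ xs) (suc i) = map-!? f xs i

opposite-just : ∀ {s : Maybe Sign} → Maybe.map opposite s ≡ just plus → s ≡ just minus
opposite-just {just minus} _ = refl

proposition3p3 : (p q : ℕ) → 0 < p → p < q → gcd p q ≡ 1 →
    (mid mid′ : Sign) → (i : ℕ) → i ≤ 4 * (p + q) ∸ 6 → i ≢ 2 * (p + q) ∸ 3 →
    (f p q mid i ≡ just minus) ⇔ (f q p mid′ i ≡ just plus)
proposition3p3 (suc a′) (suc b′) _ (s<s a′<b′) gcd≡1 mid mid′ i _ i≢centre =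
  mk⇔ (λ fᵢ≡- → trans f′≡-f (cong (Maybe.map opposite) fᵢ≡-))
      (λ f′ᵢ≡+ → opposite-just (trans (sym f′≡-f) f′ᵢ≡+))
  where
  open Reflection a′ b′ (gcd≡1⇒coprime gcd≡1)
  open ≡-Reasoning
  f′≡-f : f (suc b′) (suc a′) mid′ i ≡ Maybe.map opposite (f (suc a′) (suc b′) mid i)
  f′≡-f = begin
    H.seq mid′ !? i
      ≡⟨ cong (λ m → H.seq m !? i) (opposite-involutive mid′) ⟨
    H.seq (opposite (opposite mid′)) !? i
      ≡⟨ cong (_!? i) (seq-reflect a′<b′ (opposite mid′)) ⟩
    map opposite (G.seq (opposite mid′)) !? i
      ≡⟨ map-!? opposite (G.seq (opposite mid′)) i ⟩
    Maybe.map opposite (G.seq (opposite mid′) !? i)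
      ≡⟨ cong (Maybe.map opposite) (G.seq-mid-irrelevant (opposite mid′) mid i i≢centre) ⟩
    Maybe.map opposite (G.seq mid !? i)
      ∎
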